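{- Let $G=(V,E)$ be a finite undirected graph (loops and parallel edges allowed) and fix an orientation $\mathcal{O}$ of $G$. Then the number of distinct score vectors of orientations of $G$ equals the number of distinct score vectors of spanning subdigraphs of $G_{\mathcal{O}}$.
   Context: An orientation $\mathcal{O}$ of $G$ assigns to each edge $e$ with endpoints $v,w$ an ordered pair $\mathcal{O}(e)\in\{(v,w),(w,v)\}$ (a loop at $v$ gets $(v,v)$); $G_{\mathcal{O}}$ is the resulting digraph, where $e$ is an arc out of the first entry and into the second. A spanning subdigraph of $G_{\mathcal{O}}$ is $(V,\{\mathcal{O}(e):e\in F\})$ for some $F\subseteq E$. For a digraph $D$ on $V=\{v_1,\dots,v_n\}$, its score vector is the $n$-tuple whose $i$-th entry is (number of arcs directed out of $v_i$) minus (number of arcs directed into $v_i$). -}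

module Defs where

open import Data.Nat using (ℕ; zero; suc)
open import Data.Fin using (Fin)
open import Data.Fin.Properties using () renaming (_≟_ to _≟F_)
open import Data.Bool using (Bool; true; false; if_then_else_)
open import Data.Integer using (ℤ; _+_; _-_; 0ℤ; 1ℤ)
open import Data.Integer.Properties using () renaming (_≟_ to _≟ℤ_)
open import Data.Product using (_×_; _,_; proj₁; proj₂)
open import Data.Vec using (Vec; []; _∷_; tabulate; lookup)
open import Data.Vec.Properties using (≡-dec)
open import Data.List using (List; []; _∷_; map; concatMap; length; deduplicate; foldr; filterᵇ; allFin)
open import Relation.Nullary.Decidable using (does)

-- A finite undirected multigraph (loops and parallel edges allowed)
-- with vertex set Fin n and edge set Fin m; each edge has an (unordered)
-- pair of endpoints, stored as a pair {v,w} in some arbitrary order.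
record Graph : Set where
  field
    n     : ℕ
    m     : ℕ
    ends  : Fin m → Fin n × Fin n
open Graph public

-- An arc (tail , head).
Arc : ℕ → Set
Arc n = Fin n × Fin n

-- An orientation of G: for each edge e with ends e = (v , w),
-- true means O(e) = (v , w) and false means O(e) = (w , v).
Orientation : Graph → Set
Orientation G = Vec Bool (m G)

orientArc : (G : Graph) → Orientation G → Fin (m G) → Arc (n G)
orientArc G O e with lookup O e | ends G e
... | true  | (v , w) = (v , w)
... | false | (v , w) = (w , v)

ind : Bool → ℤ
ind true  = 1ℤ
ind false = 0ℤ

-- Score vector of a digraph on Fin n given by a list of arcs:
-- entry i = (#arcs out of i) - (#arcs into i).
score : (k : ℕ) → List (Arc k) → Vec ℤ k
score k as = tabulate λ i →
  foldr (λ a acc → acc + (ind (does (proj₁ a ≟F i)) - ind (does (proj₂ a ≟F i)))) 0ℤ as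

allFinL : (k : ℕ) → List (Fin k)
allFinL k = allFin k

orientedArcs : (G : Graph) → Orientation G → List (Arc (n G))
orientedArcs G O = map (orientArc G O) (allFinL (m G))

-- A spanning subdigraph of G_O, given by F ⊆ E (as a characteristic vector):
-- arcs are O(e) for e ∈ F.
filterArcs : (G : Graph) → Orientation G → Vec Bool (m G) → List (Arc (n G))
filterArcs G O F = map (orientArc G O) (filterᵇ (lookup F) (allFinL (m G)))

allBoolVecs : (k : ℕ) → List (Vec Bool k)
allBoolVecs zero    = [] ∷ []
allBoolVecs (suc k) = concatMap (λ v → (true ∷ v) ∷ (false ∷ v) ∷ []) (allBoolVecs k)

#distinct : {k : ℕ} → List (Vec ℤ k) → ℕ
#distinct xs = length (deduplicate (≡-dec _≟ℤ_) xs)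

#orientationScores : Graph → ℕ
#orientationScores G =
  #distinct (map (λ O → score (n G) (orientedArcs G O)) (allBoolVecs (m G)))

#subdigraphScores : (G : Graph) → Orientation G → ℕ
#subdigraphScores G O =
  #distinct (map (λ F → score (n G) (filterArcs G O F)) (allBoolVecs (m G)))

{-# OPTIONS --safe #-}
module Submission where

-- Write O ⊕ F for the orientation obtained from O by reversing the edges in F.
-- Reversing an arc negates its contribution to the score, so
--   score (G_{O ⊕ F}) = score (G_O) − 2 · score (F-subdigraph of G_O).
-- As F ranges over all edge sets, O ⊕ F ranges over all orientations, and
-- v ↦ score (G_O) − 2v is injective; hence both families of score vectors have
-- the same number of distinct members.

open import Defs
open import Algebra.Definitions using (Involutive)
open import Data.Nat using (ℕ; zero; suc)
open import Data.Bool using (Bool; true; false; _xor_)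
open import Data.Bool.Properties using (xor-assoc; xor-same)
open import Data.Fin using (Fin; zero; suc)
open import Data.Fin.Properties using () renaming (_≟_ to _≟F_)
open import Data.Integer using (ℤ; +_; _+_; _-_; _*_; -_; 0ℤ)
open import Data.Integer.Properties using (+-0-abelianGroup; *-cancelˡ-≡) renaming (_≟_ to _≟ℤ_)
open import Data.Integer.Tactic.RingSolver using (solve-∀)
open import Data.List using (List; []; _∷_; map; concatMap; length; deduplicate; foldr; filterᵇ; allFin)
open import Data.List.Properties using (length-map; map-∘) renaming (map-cong to map-cong-≗)
open import Data.List.Membership.Propositional using (_∈_)
open import Data.List.Membership.Propositional.Properties using (∈-map⁺; deduplicate-∈⇔)
open import Data.List.Membership.Propositional.Properties.WithK using (unique∧set⇒bag)
open import Data.List.Relation.Binary.BagAndSetEquality using (set; _∼[_]_; map-cong; ∼bag⇒↭)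
open import Data.List.Relation.Binary.Permutation.Propositional.Properties using (↭-length)
open import Data.List.Relation.Unary.Any using (here; there)
open import Data.List.Relation.Unary.Unique.DecPropositional.Properties using (deduplicate-!)
open import Data.List.Relation.Unary.Unique.Propositional.Properties using () renaming (map⁺ to unique-map⁺)
open import Data.Product using (_,_; proj₁; proj₂; swap)
open import Data.Vec using (Vec; []; _∷_; tabulate; lookup; zipWith)
open import Data.Vec.Properties using (≡-dec; lookup-zipWith; ∷-injective; tabulate-cong)
open import Function using (_∘_; id; Injective; mk⇔)
open import Function.Related.Propositional using (SK-sym; module EquationalReasoning)
open import Relation.Binary.Definitions using (DecidableEquality)
open import Relation.Binary.PropositionalEquality using (_≡_; refl; sym; trans; cong; cong₂; subst; module ≡-Reasoning)
open import Relation.Nullary.Decidable using (does)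

open import Algebra.Properties.AbelianGroup +-0-abelianGroup using (∙-cancelˡ; ⁻¹-injective; ⁻¹-anti-homo‿-)

private
  variable
    k : ℕ

module _ {a} {A : Set a} (_≟_ : DecidableEquality A) where

  length-deduplicate-cong : {xs ys : List A} → xs ∼[ set ] ys →
    length (deduplicate _≟_ xs) ≡ length (deduplicate _≟_ ys)
  length-deduplicate-cong {xs} {ys} xs≈ys =
    ↭-length (∼bag⇒↭ (unique∧set⇒bag (deduplicate-! _≟_ xs) (deduplicate-! _≟_ ys) same))
    where
    open EquationalReasoning
    same : deduplicate _≟_ xs ∼[ set ] deduplicate _≟_ ys
    same {z} = begin
      z ∈ deduplicate _≟_ xs ∼⟨ SK-sym (deduplicate-∈⇔ _≟_) ⟩
      z ∈ xs                 ∼⟨ xs≈ys ⟩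
      z ∈ ys                 ∼⟨ deduplicate-∈⇔ _≟_ ⟩
      z ∈ deduplicate _≟_ ys ∎

module _ {a b} {A : Set a} {B : Set b}
         (_≟ᴬ_ : DecidableEquality A) (_≟ᴮ_ : DecidableEquality B) where

  length-deduplicate-map-injective : {f : A → B} → Injective _≡_ _≡_ f → (xs : List A) →
    length (deduplicate _≟ᴮ_ (map f xs)) ≡ length (deduplicate _≟ᴬ_ xs)
  length-deduplicate-map-injective {f} f-inj xs =
    trans (↭-length (∼bag⇒↭ (unique∧set⇒bag (deduplicate-! _≟ᴮ_ (map f xs))
                                             (unique-map⁺ f-inj (deduplicate-! _≟ᴬ_ xs)) same)))
          (length-map f (deduplicate _≟ᴬ_ xs))
    where
    open EquationalReasoning
    same : deduplicate _≟ᴮ_ (map f xs) ∼[ set ] map f (deduplicate _≟ᴬ_ xs)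
    same {z} = begin
      z ∈ deduplicate _≟ᴮ_ (map f xs) ∼⟨ SK-sym (deduplicate-∈⇔ _≟ᴮ_) ⟩
      z ∈ map f xs                    ∼⟨ map-cong (λ _ → refl) (deduplicate-∈⇔ _≟ᴬ_) ⟩
      z ∈ map f (deduplicate _≟ᴬ_ xs) ∎

module _ {a} {A : Set a} where

  enumerations-∼set : {xs ys : List A} → (∀ x → x ∈ xs) → (∀ y → y ∈ ys) → xs ∼[ set ] ys
  enumerations-∼set xs-all ys-all {z} = mk⇔ (λ _ → ys-all z) (λ _ → xs-all z)

  map-involutive-enumeration : {π : A → A} {xs : List A} → Involutive _≡_ π →
    (∀ x → x ∈ xs) → ∀ x → x ∈ map π xs
  map-involutive-enumeration {π} {xs} π-invol xs-all x =
    subst (_∈ map π xs) (π-invol x) (∈-map⁺ π (xs-all (π x)))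

∈-allBoolVecs : (v : Vec Bool k) → v ∈ allBoolVecs k
∈-allBoolVecs [] = here refl
∈-allBoolVecs (b ∷ v) = ∈-pairs b (∈-allBoolVecs v)
  where
  ∈-pairs : ∀ {k} {v : Vec Bool k} {vs} b → v ∈ vs →
    (b ∷ v) ∈ concatMap (λ w → (true ∷ w) ∷ (false ∷ w) ∷ []) vs
  ∈-pairs true  (here refl) = here refl
  ∈-pairs false (here refl) = there (here refl)
  ∈-pairs b     (there v∈)  = there (there (∈-pairs b v∈))

zipWith-tabulate : ∀ {a b c} {A : Set a} {B : Set b} {C : Set c}
  (f : A → B → C) (g : Fin k → A) (h : Fin k → B) →
  zipWith f (tabulate g) (tabulate h) ≡ tabulate (λ i → f (g i) (h i))
zipWith-tabulate {k = zero}  f g h = refl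
zipWith-tabulate {k = suc k} f g h =
  cong (f (g zero) (h zero) ∷_) (zipWith-tabulate f (g ∘ suc) (h ∘ suc))

zipWith-injectiveʳ : ∀ {a b c} {A : Set a} {B : Set b} {C : Set c} {f : A → B → C} →
  (∀ x → Injective _≡_ _≡_ (f x)) → (xs : Vec A k) → Injective _≡_ _≡_ (zipWith f xs)
zipWith-injectiveʳ f-inj [] {[]} {[]} _ = refl
zipWith-injectiveʳ f-inj (x ∷ xs) {y ∷ ys} {z ∷ zs} eq =
  let y≡z , ys≡zs = ∷-injective eq in
  cong₂ _∷_ (f-inj x y≡z) (zipWith-injectiveʳ f-inj xs ys≡zs)

minusTwice : Vec ℤ k → Vec ℤ k → Vec ℤ k
minusTwice = zipWith (λ x y → x - + 2 * y)

minusTwice-injective : (c : Vec ℤ k) → Injective _≡_ _≡_ (minusTwice c)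
minusTwice-injective = zipWith-injectiveʳ λ x {y} {z} eq →
  *-cancelˡ-≡ (+ 2) y z (⁻¹-injective (∙-cancelˡ x _ _ eq))

netOut : Fin k → Arc k → ℤ
netOut i a = ind (does (proj₁ a ≟F i)) - ind (does (proj₂ a ≟F i))

-- score k as is definitionally tabulate (λ i → netOutSum i as).
netOutSum : Fin k → List (Arc k) → ℤ
netOutSum i = foldr (λ a acc → acc + netOut i a) 0ℤ

netOut-swap : (i : Fin k) (a : Arc k) → netOut i (swap a) ≡ - netOut i a
netOut-swap i (v , w) = sym (⁻¹-anti-homo‿- (ind (does (v ≟F i))) (ind (does (w ≟F i))))

reverseIf : Bool → Arc k → Arc k
reverseIf true  = swap
reverseIf false = id

netOutSum-reverseIf : ∀ {x} {X : Set x} (i : Fin k) (σ : X → Bool) (arc : X → Arc k) (xs : List X) →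
  netOutSum i (map (λ e → reverseIf (σ e) (arc e)) xs)
    ≡ netOutSum i (map arc xs) - + 2 * netOutSum i (map arc (filterᵇ σ xs))
netOutSum-reverseIf i σ arc [] = refl
netOutSum-reverseIf i σ arc (e ∷ xs) with σ e
... | true  = trans (cong₂ _+_ (netOutSum-reverseIf i σ arc xs) (netOut-swap i (arc e)))
                    (reversed-step (netOutSum i (map arc xs))
                                   (netOutSum i (map arc (filterᵇ σ xs))) (netOut i (arc e)))
  where
  reversed-step : ∀ a b d → (a - + 2 * b) + - d ≡ (a + d) - + 2 * (b + d)
  reversed-step = solve-∀
... | false = trans (cong (_+ netOut i (arc e)) (netOutSum-reverseIf i σ arc xs))
                    (kept-step (netOutSum i (map arc xs))
                               (netOutSum i (map arc (filterᵇ σ xs))) (netOut i (arc e)))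
  where
  kept-step : ∀ a b d → (a - + 2 * b) + d ≡ (a + d) - + 2 * b
  kept-step = solve-∀

score-reverseIf : ∀ {x} {X : Set x} (σ : X → Bool) (arc : X → Arc k) (xs : List X) →
  score k (map (λ e → reverseIf (σ e) (arc e)) xs)
    ≡ minusTwice (score k (map arc xs)) (score k (map arc (filterᵇ σ xs)))
score-reverseIf σ arc xs = sym (trans
  (zipWith-tabulate _ (λ i → netOutSum i (map arc xs)) (λ i → netOutSum i (map arc (filterᵇ σ xs))))
  (tabulate-cong (λ i → sym (netOutSum-reverseIf i σ arc xs))))

_⊕_ : Vec Bool k → Vec Bool k → Vec Bool k
_⊕_ = zipWith _xor_

⊕-involutive : (O : Vec Bool k) → Involutive _≡_ (O ⊕_)
⊕-involutive []      []      = refl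
⊕-involutive (b ∷ O) (c ∷ F) =
  cong₂ _∷_ (trans (sym (xor-assoc b b c)) (cong (_xor c) (xor-same b))) (⊕-involutive O F)

orientArc-⊕ : (G : Graph) (O : Orientation G) (F : Vec Bool (m G)) (e : Fin (m G)) →
  orientArc G (O ⊕ F) e ≡ reverseIf (lookup F e) (orientArc G O e)
orientArc-⊕ G O F e rewrite lookup-zipWith _xor_ e O F with lookup O e | lookup F e | ends G e
... | true  | true  | (v , w) = refl
... | true  | false | (v , w) = refl
... | false | true  | (v , w) = refl
... | false | false | (v , w) = refl

score-⊕ : (G : Graph) (O : Orientation G) (F : Vec Bool (m G)) →
  score (n G) (orientedArcs G (O ⊕ F))
    ≡ minusTwice (score (n G) (orientedArcs G O)) (score (n G) (filterArcs G O F))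
score-⊕ G O F = trans
  (cong (score (n G)) (map-cong-≗ (orientArc-⊕ G O F) (allFin (m G))))
  (score-reverseIf (lookup F) (orientArc G O) (allFin (m G)))

lemma2p14 : (G : Graph) → (O : Orientation G) →
    #orientationScores G ≡ #subdigraphScores G O
lemma2p14 G O = begin
  #distinct (map orientationScore edgeSets)
    ≡⟨ length-deduplicate-cong ≟-score (map-cong (λ _ → refl) edgeSets≈reversals) ⟩
  #distinct (map orientationScore (map (O ⊕_) edgeSets))
    ≡⟨ cong #distinct (trans (sym (map-∘ edgeSets)) (map-cong-≗ (score-⊕ G O) edgeSets)) ⟩
  #distinct (map (minusTwice (orientationScore O) ∘ subdigraphScore) edgeSets)
    ≡⟨ cong #distinct (map-∘ edgeSets) ⟩
  #distinct (map (minusTwice (orientationScore O)) (map subdigraphScore edgeSets))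
    ≡⟨ length-deduplicate-map-injective ≟-score ≟-score
         (minusTwice-injective (orientationScore O)) (map subdigraphScore edgeSets) ⟩
  #distinct (map subdigraphScore edgeSets) ∎
  where
  open ≡-Reasoning
  ≟-score : DecidableEquality (Vec ℤ (n G))
  ≟-score = ≡-dec _≟ℤ_
  edgeSets : List (Vec Bool (m G))
  edgeSets = allBoolVecs (m G)
  orientationScore : Orientation G → Vec ℤ (n G)
  orientationScore O′ = score (n G) (orientedArcs G O′)
  subdigraphScore : Vec Bool (m G) → Vec ℤ (n G)
  subdigraphScore F = score (n G) (filterArcs G O F)
  edgeSets≈reversals : edgeSets ∼[ set ] map (O ⊕_) edgeSets
  edgeSets≈reversals = enumerations-∼set ∈-allBoolVecs
    (map-involutive-enumeration (⊕-involutive O) ∈-allBoolVecs)
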